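{- Let $\Gamma,\Delta$ be contexts, let $P\in\mathrm{Proc}(\Gamma)$, let $a$ be an action in $\Gamma$, let $Q\in\mathrm{Proc}(\Gamma+|a|)$ with $P\xrightarrow{a}Q$, and let $\rho:\Gamma\to\Delta$ be a renaming. Then $\rho P\xrightarrow{\rho a}(\rho+|a|)Q$.
   Context: Synchronous $\pi$-calculus with de Bruijn indices. Contexts $\Gamma$ are natural numbers; a name in $\Gamma$ is a natural number $x<\Gamma$. The set $\mathrm{Proc}(\Gamma)$ of processes closed by $\Gamma$ is defined inductively: $\mathbf{0}\in\mathrm{Proc}(\Gamma)$; if $x<\Gamma$ and $P\in\mathrm{Proc}(\Gamma+1)$ then $\mathsf{in}\,x.P\in\mathrm{Proc}(\Gamma)$ (input on $x$, binding index $0$ in $P$); if $x,y<\Gamma$ and $P\in\mathrm{Proc}(\Gamma)$ then $\overline{x}\langle y\rangle.P\in\mathrm{Proc}(\Gamma)$; if $P,Q\in\mathrm{Proc}(\Gamma)$ then $P+Q$ and $P\mid Q$ are in $\mathrm{Proc}(\Gamma)$; if $P\in\mathrm{Proc}(\Gamma+1)$ then $\nu P\in\mathrm{Proc}(\Gamma)$; if $P\in\mathrm{Proc}(\Gamma)$ then $!P\in\mathrm{Proc}(\Gamma)$. Actions in $\Gamma$ are: bound actions $\mathsf{in}\,x$ (input) and $\overline{x}\langle\cdot\rangle$ (bound output) for $x<\Gamma$, and non-bound actions $\overline{x}\langle y\rangle$ (output) for $x,y<\Gamma$ and $\tau$. Set $|a|=1$ if $a$ is bound and $|a|=0$ otherwise.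 A renaming $\rho:\Gamma\to\Delta$ is any function $\{0,\dots,\Gamma-1\}\to\{0,\dots,\Delta-1\}$. Its lifting $\rho+1:\Gamma+1\to\Delta+1$ maps $0\mapsto0$ and $x+1\mapsto\rho(x)+1$; $\rho+n$ denotes the $n$-fold lifting. Renamings act on actions by renaming every name ($\rho\tau=\tau$), and on processes by: $\rho\mathbf{0}=\mathbf{0}$, $\rho(\mathsf{in}\,x.P)=\mathsf{in}\,\rho(x).((\rho+1)P)$, $\rho(\overline{x}\langle y\rangle.P)=\overline{\rho x}\langle\rho y\rangle.\rho P$, $\rho(P+Q)=\rho P+\rho Q$, $\rho(P\mid Q)=\rho P\mid\rho Q$, $\rho(\nu P)=\nu((\rho+1)P)$, $\rho(!P)=!\rho P$. Special renamings: $\mathsf{push}:\Gamma\to\Gamma+1$, $x\mapsto x+1$; for $y<\Gamma$, $\mathsf{pop}\,y:\Gamma+1\to\Gamma$, $0\mapsto y$, $x+1\mapsto x$; $\mathsf{swap}:\Gamma+2\to\Gamma+2$ exchanging $0$ and $1$ and fixing all $x\ge2$. Transitions: for $P\in\mathrm{Proc}(\Gamma)$, an action $a$ in $\Gamma$ and $R\in\mathrm{Proc}(\Gamma+|a|)$, the relation $P\xrightarrow{a}R$ is the least relation closed under the following rules ($b$ ranges over bound actions, $c$ over non-bound actions): $\mathsf{in}\,x.P\xrightarrow{\mathsf{in}\,x}P$; $\overline{x}\langle y\rangle.P\xrightarrow{\overline{x}\langle y\rangle}P$; if $P\xrightarrow{a}R$ then $P+Q\xrightarrow{a}R$; if $Q\xrightarrow{a}S$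 then $P+Q\xrightarrow{a}S$; if $P\xrightarrow{c}R$ then $P\mid Q\xrightarrow{c}R\mid Q$; if $Q\xrightarrow{c}S$ then $P\mid Q\xrightarrow{c}P\mid S$; if $P\xrightarrow{b}R$ then $P\mid Q\xrightarrow{b}R\mid\mathsf{push}\,Q$; if $Q\xrightarrow{b}S$ then $P\mid Q\xrightarrow{b}\mathsf{push}\,P\mid S$; if $P\xrightarrow{\mathsf{in}\,x}R$ and $Q\xrightarrow{\overline{x}\langle y\rangle}S$ then $P\mid Q\xrightarrow{\tau}(\mathsf{pop}\,y)R\mid S$; symmetrically if $P\xrightarrow{\overline{x}\langle y\rangle}R$ and $Q\xrightarrow{\mathsf{in}\,x}S$ then $P\mid Q\xrightarrow{\tau}R\mid(\mathsf{pop}\,y)S$; if $P\xrightarrow{\overline{x+1}\langle 0\rangle}R$ then $\nu P\xrightarrow{\overline{x}\langle\cdot\rangle}R$; if $P\xrightarrow{\mathsf{in}\,x}R$ and $Q\xrightarrow{\overline{x}\langle\cdot\rangle}S$ then $P\mid Q\xrightarrow{\tau}\nu(R\mid S)$; symmetrically if $P\xrightarrow{\overline{x}\langle\cdot\rangle}R$ and $Q\xrightarrow{\mathsf{in}\,x}S$ then $P\mid Q\xrightarrow{\tau}\nu(R\mid S)$; if $P\xrightarrow{\mathsf{push}\,c}R$ then $\nu P\xrightarrow{c}\nu R$; if $P\xrightarrow{\mathsf{push}\,b}R$ then $\nu P\xrightarrow{b}\nu(\mathsf{swap}\,R)$; if $P\mid !P\xrightarrow{a}R$ then $!P\xrightarrow{a}R$.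 -}

module Defs where

open import Data.Nat using (ℕ; zero; suc; _+_)
open import Data.Fin using (Fin; zero; suc)

data Proc (Γ : ℕ) : Set where
  𝟎    : Proc Γ
  inp  : Fin Γ → Proc (suc Γ) → Proc Γ           -- in x . P   (binds index 0)
  out  : Fin Γ → Fin Γ → Proc Γ → Proc Γ         -- x̄⟨y⟩ . P
  _⊕_  : Proc Γ → Proc Γ → Proc Γ
  _∥_  : Proc Γ → Proc Γ → Proc Γ
  ν    : Proc (suc Γ) → Proc Γ
  !_   : Proc Γ → Proc Γ

data BAction (Γ : ℕ) : Set where
  inA   : Fin Γ → BAction Γ
  boutA : Fin Γ → BAction Γ

data CAction (Γ : ℕ) : Set where
  outA : Fin Γ → Fin Γ → CAction Γ   -- x̄⟨y⟩
  τ    : CAction Γ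

-- Actions are indexed by |a| ∈ {0,1}, so that renaming preserves |a| definitionally.
data Action (Γ : ℕ) : ℕ → Set where
  bnd  : BAction Γ → Action Γ 1
  nbnd : CAction Γ → Action Γ 0

Ren : ℕ → ℕ → Set
Ren Γ Δ = Fin Γ → Fin Δ

lift : ∀ {Γ Δ} → Ren Γ Δ → Ren (suc Γ) (suc Δ)
lift ρ zero    = zero
lift ρ (suc x) = suc (ρ x)

-- n-fold lifting ρ + n  (context Γ + n is written n + Γ so that it computes).
liftN : ∀ {Γ Δ} (n : ℕ) → Ren Γ Δ → Ren (n + Γ) (n + Δ)
liftN zero    ρ = ρ
liftN (suc n) ρ = lift (liftN n ρ)

renB : ∀ {Γ Δ} → Ren Γ Δ → BAction Γ → BAction Δ
renB ρ (inA x)   = inA (ρ x)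
renB ρ (boutA x) = boutA (ρ x)

renC : ∀ {Γ Δ} → Ren Γ Δ → CAction Γ → CAction Δ
renC ρ (outA x y) = outA (ρ x) (ρ y)
renC ρ τ          = τ

renA : ∀ {Γ Δ n} → Ren Γ Δ → Action Γ n → Action Δ n
renA ρ (bnd b)  = bnd (renB ρ b)
renA ρ (nbnd c) = nbnd (renC ρ c)

ren : ∀ {Γ Δ} → Ren Γ Δ → Proc Γ → Proc Δ
ren ρ 𝟎         = 𝟎
ren ρ (inp x P) = inp (ρ x) (ren (lift ρ) P)
ren ρ (out x y P) = out (ρ x) (ρ y) (ren ρ P)
ren ρ (P ⊕ Q)   = ren ρ P ⊕ ren ρ Q
ren ρ (P ∥ Q)   = ren ρ P ∥ ren ρ Q
ren ρ (ν P)     = ν (ren (lift ρ) P)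
ren ρ (! P)     = ! ren ρ P

push : ∀ {Γ} → Ren Γ (suc Γ)
push x = suc x

pop : ∀ {Γ} → Fin Γ → Ren (suc Γ) Γ
pop y zero    = y
pop y (suc x) = x

swap : ∀ {Γ} → Ren (suc (suc Γ)) (suc (suc Γ))
swap zero          = suc zero
swap (suc zero)    = zero
swap (suc (suc x)) = suc (suc x)

infix 4 _—[_]→_
data _—[_]→_ {Γ : ℕ} : {n : ℕ} → Proc Γ → Action Γ n → Proc (n + Γ) → Set where
  t-in   : ∀ {x P} → inp x P —[ bnd (inA x) ]→ P
  t-out  : ∀ {x y P} → out x y P —[ nbnd (outA x y) ]→ P
  t-sumˡ : ∀ {n P Q} {a : Action Γ n} {R} → P —[ a ]→ R → (P ⊕ Q) —[ a ]→ R
  t-sumʳ : ∀ {n P Q} {a : Action Γ n} {S} → Q —[ a ]→ S → (P ⊕ Q) —[ a ]→ S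
  t-parˡᶜ : ∀ {P Q c R} → P —[ nbnd c ]→ R → (P ∥ Q) —[ nbnd c ]→ (R ∥ Q)
  t-parʳᶜ : ∀ {P Q c S} → Q —[ nbnd c ]→ S → (P ∥ Q) —[ nbnd c ]→ (P ∥ S)
  t-parˡᵇ : ∀ {P Q b R} → P —[ bnd b ]→ R → (P ∥ Q) —[ bnd b ]→ (R ∥ ren push Q)
  t-parʳᵇ : ∀ {P Q b S} → Q —[ bnd b ]→ S → (P ∥ Q) —[ bnd b ]→ (ren push P ∥ S)
  t-commˡ : ∀ {P Q x y R S} → P —[ bnd (inA x) ]→ R → Q —[ nbnd (outA x y) ]→ S
          → (P ∥ Q) —[ nbnd τ ]→ (ren (pop y) R ∥ S)
  t-commʳ : ∀ {P Q x y R S} → P —[ nbnd (outA x y) ]→ R → Q —[ bnd (inA x) ]→ S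
          → (P ∥ Q) —[ nbnd τ ]→ (R ∥ ren (pop y) S)
  t-open  : ∀ {P x R} → P —[ nbnd (outA (suc x) zero) ]→ R → ν P —[ bnd (boutA x) ]→ R
  t-closeˡ : ∀ {P Q x R S} → P —[ bnd (inA x) ]→ R → Q —[ bnd (boutA x) ]→ S
           → (P ∥ Q) —[ nbnd τ ]→ ν (R ∥ S)
  t-closeʳ : ∀ {P Q x R S} → P —[ bnd (boutA x) ]→ R → Q —[ bnd (inA x) ]→ S
           → (P ∥ Q) —[ nbnd τ ]→ ν (R ∥ S)
  t-resᶜ : ∀ {P c R} → P —[ nbnd (renC push c) ]→ R → ν P —[ nbnd c ]→ ν R
  t-resᵇ : ∀ {P b R} → P —[ bnd (renB push b) ]→ R → ν P —[ bnd b ]→ ν (ren swap R)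
  t-rep  : ∀ {n P} {a : Action Γ n} {R} → (P ∥ (! P)) —[ a ]→ R → (! P) —[ a ]→ R

-- Every rule commutes with renaming on the nose
-- except where a rule itself applies a renaming (push, pop, swap) to a
-- residual or an action; there one needs that ρ, suitably lifted, commutes
-- with that renaming, which holds because renaming is functorial and
-- ρ ∘ pop y = pop (ρ y) ∘ lift ρ, lift ρ ∘ push = push ∘ ρ and
-- lift (lift ρ) ∘ swap = swap ∘ lift (lift ρ).
module Submission where

open import Defs
open import Data.Nat using (ℕ; _+_)
open import Data.Fin using (zero; suc)
open import Function using (_∘_)
open import Relation.Binary.PropositionalEquality
  using (_≡_; refl; sym; trans; cong; cong₂; subst; _≗_)

lift-cong : ∀ {Γ Δ} {f g : Ren Γ Δ} → f ≗ g → lift f ≗ lift g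
lift-cong f≗g zero    = refl
lift-cong f≗g (suc x) = cong suc (f≗g x)

ren-cong : ∀ {Γ Δ} {f g : Ren Γ Δ} → f ≗ g → ren f ≗ ren g
ren-cong f≗g 𝟎           = refl
ren-cong f≗g (inp x P)   = cong₂ inp (f≗g x) (ren-cong (lift-cong f≗g) P)
ren-cong f≗g (out x y P) rewrite f≗g x | f≗g y = cong (out _ _) (ren-cong f≗g P)
ren-cong f≗g (P ⊕ Q)     = cong₂ _⊕_ (ren-cong f≗g P) (ren-cong f≗g Q)
ren-cong f≗g (P ∥ Q)     = cong₂ _∥_ (ren-cong f≗g P) (ren-cong f≗g Q)
ren-cong f≗g (ν P)       = cong ν (ren-cong (lift-cong f≗g) P)
ren-cong f≗g (! P)       = cong !_ (ren-cong f≗g P)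

lift-∘ : ∀ {Γ Δ Θ} (f : Ren Δ Θ) (g : Ren Γ Δ) → lift f ∘ lift g ≗ lift (f ∘ g)
lift-∘ f g zero    = refl
lift-∘ f g (suc x) = refl

ren-∘ : ∀ {Γ Δ Θ} (f : Ren Δ Θ) (g : Ren Γ Δ) → ren f ∘ ren g ≗ ren (f ∘ g)
ren-∘ f g 𝟎           = refl
ren-∘ f g (inp x P)   = cong (inp _) (trans (ren-∘ _ _ P) (ren-cong (lift-∘ f g) P))
ren-∘ f g (out x y P) = cong (out _ _) (ren-∘ f g P)
ren-∘ f g (P ⊕ Q)     = cong₂ _⊕_ (ren-∘ f g P) (ren-∘ f g Q)
ren-∘ f g (P ∥ Q)     = cong₂ _∥_ (ren-∘ f g P) (ren-∘ f g Q)
ren-∘ f g (ν P)       = cong ν (trans (ren-∘ _ _ P) (ren-cong (lift-∘ f g) P))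
ren-∘ f g (! P)       = cong !_ (ren-∘ f g P)

ren-square : ∀ {Γ Γ′ Δ Δ′} (f : Ren Δ Δ′) (g : Ren Γ Δ) (h : Ren Γ′ Δ′) (k : Ren Γ Γ′)
           → f ∘ g ≗ h ∘ k → ren f ∘ ren g ≗ ren h ∘ ren k
ren-square f g h k fg≗hk P =
  trans (ren-∘ f g P) (trans (ren-cong fg≗hk P) (sym (ren-∘ h k P)))

ren-push-comm : ∀ {Γ Δ} (ρ : Ren Γ Δ) → ren push ∘ ren ρ ≗ ren (lift ρ) ∘ ren push
ren-push-comm ρ = ren-square _ _ _ _ λ x → refl

ren-pop-comm : ∀ {Γ Δ} (ρ : Ren Γ Δ) y
             → ren (pop (ρ y)) ∘ ren (lift ρ) ≗ ren ρ ∘ ren (pop y)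
ren-pop-comm ρ y = ren-square _ _ _ _ λ { zero → refl ; (suc x) → refl }

ren-swap-comm : ∀ {Γ Δ} (ρ : Ren Γ Δ)
              → ren swap ∘ ren (lift (lift ρ)) ≗ ren (lift (lift ρ)) ∘ ren swap
ren-swap-comm ρ = ren-square _ _ _ _ λ { zero → refl ; (suc zero) → refl ; (suc (suc x)) → refl }

renB-push-comm : ∀ {Γ Δ} (ρ : Ren Γ Δ) b → renB (lift ρ) (renB push b) ≡ renB push (renB ρ b)
renB-push-comm ρ (inA x)   = refl
renB-push-comm ρ (boutA x) = refl

renC-push-comm : ∀ {Γ Δ} (ρ : Ren Γ Δ) c → renC (lift ρ) (renC push c) ≡ renC push (renC ρ c)
renC-push-comm ρ (outA x y) = refl
renC-push-comm ρ τ          = refl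

retarget : ∀ {Γ n} {P : Proc Γ} {a : Action Γ n} {Q Q′} → Q ≡ Q′ → P —[ a ]→ Q → P —[ a ]→ Q′
retarget {P = P} {a} = subst (P —[ a ]→_)

relabel : ∀ {Γ n} {P : Proc Γ} {a a′ : Action Γ n} {Q} → a ≡ a′ → P —[ a ]→ Q → P —[ a′ ]→ Q
relabel {P = P} {Q = Q} = subst (λ a → P —[ a ]→ Q)

lemma2p9 : ∀ {Γ Δ n : ℕ} {P : Proc Γ} {a : Action Γ n} {Q : Proc (n + Γ)}
           → P —[ a ]→ Q → (ρ : Ren Γ Δ)
           → ren ρ P —[ renA ρ a ]→ ren (liftN n ρ) Q
lemma2p9 t-in              ρ = t-in
lemma2p9 t-out             ρ = t-out
lemma2p9 (t-sumˡ t)        ρ = t-sumˡ (lemma2p9 t ρ)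
lemma2p9 (t-sumʳ t)        ρ = t-sumʳ (lemma2p9 t ρ)
lemma2p9 (t-parˡᶜ t)       ρ = t-parˡᶜ (lemma2p9 t ρ)
lemma2p9 (t-parʳᶜ t)       ρ = t-parʳᶜ (lemma2p9 t ρ)
lemma2p9 (t-parˡᵇ {Q = Q} t) ρ =
  retarget (cong (_ ∥_) (ren-push-comm ρ Q)) (t-parˡᵇ (lemma2p9 t ρ))
lemma2p9 (t-parʳᵇ {P = P} t) ρ =
  retarget (cong (_∥ _) (ren-push-comm ρ P)) (t-parʳᵇ (lemma2p9 t ρ))
lemma2p9 (t-commˡ {y = y} {R = R} t u) ρ =
  retarget (cong (_∥ _) (ren-pop-comm ρ y R)) (t-commˡ (lemma2p9 t ρ) (lemma2p9 u ρ))
lemma2p9 (t-commʳ {y = y} {S = S} t u) ρ =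
  retarget (cong (_ ∥_) (ren-pop-comm ρ y S)) (t-commʳ (lemma2p9 t ρ) (lemma2p9 u ρ))
lemma2p9 (t-open t)        ρ = t-open (lemma2p9 t (lift ρ))
lemma2p9 (t-closeˡ t u)    ρ = t-closeˡ (lemma2p9 t ρ) (lemma2p9 u ρ)
lemma2p9 (t-closeʳ t u)    ρ = t-closeʳ (lemma2p9 t ρ) (lemma2p9 u ρ)
lemma2p9 (t-resᶜ {c = c} t) ρ =
  t-resᶜ (relabel (cong nbnd (renC-push-comm ρ c)) (lemma2p9 t (lift ρ)))
lemma2p9 (t-resᵇ {b = b} {R = R} t) ρ =
  retarget (cong ν (ren-swap-comm ρ R))
    (t-resᵇ (relabel (cong bnd (renB-push-comm ρ b)) (lemma2p9 t (lift ρ))))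
lemma2p9 (t-rep t)         ρ = t-rep (lemma2p9 t ρ)
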